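{- For every integer $m\ge1$, $$\sum_{k\ge1}\frac{\prod_{i=1}^{m}q^{2k+2i-1}}{\prod_{i=0}^{m}(1+q^{2k+2i})}=\frac{q^{2m}}{1-q^{2m}}\cdot\frac{\prod_{i=1}^{m}q^{2i-1}}{\prod_{i=1}^{m}(1+q^{2i})}.$$
   Context: The identity is understood as an identity of formal power series in $q$ (equivalently, of analytic functions for $|q|<1$). -}

module Defs where

-- Formal power series in q with integer coefficients, as coefficient functions.

open import Data.Nat using (ℕ; zero; suc; _≡ᵇ_; _∸_)
open import Data.Integer using (ℤ; 0ℤ; 1ℤ; _+_; _*_; -_)
open import Data.Bool using (if_then_else_)

Series : Set
Series = ℕ → ℤ

sumTo : ℕ → (ℕ → ℤ) → ℤ
sumTo zero    f = 0ℤ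
sumTo (suc n) f = sumTo n f + f n

qpow : ℕ → Series
qpow e n = if n ≡ᵇ e then 1ℤ else 0ℤ

one : Series
one = qpow 0

_⊕_ : Series → Series → Series
(f ⊕ g) n = f n + g n

⊖_ : Series → Series
(⊖ f) n = - f n

_⊝_ : Series → Series → Series
f ⊝ g = f ⊕ (⊖ g)

_⊛_ : Series → Series → Series
(f ⊛ g) n = sumTo (suc n) (λ i → f i * g (n ∸ i))

prodTo : ℕ → (ℕ → Series) → Series
prodTo zero    F = one
prodTo (suc m) F = prodTo m F ⊛ F m

sumSeries : ℕ → (ℕ → Series) → Series
sumSeries zero    F = λ _ → 0ℤ
sumSeries (suc m) F = sumSeries m F ⊕ F m

-- Multiplicative inverse of a series f with constant term f 0 = 1,
-- computed by the standard recursion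
--   g 0 = 1,  g n = - Σ_{i=1}^{n} f i * g (n - i).
-- invApprox f n is a function that is correct on all indices ≤ n.
invApprox : Series → ℕ → (ℕ → ℤ)
invApprox f zero    i = if i ≡ᵇ 0 then 1ℤ else 0ℤ
invApprox f (suc n) i =
  if i ≡ᵇ suc n
  then - sumTo (suc n) (λ j → f (suc j) * invApprox f n (n ∸ j))
  else invApprox f n i

inv : Series → Series
inv f n = invApprox f n n

-- f / g  (g with constant term 1)
_⊘_ : Series → Series → Series
f ⊘ g = f ⊛ inv g

{-# OPTIONS --safe #-}
module Submission where

open import Algebra.Bundles using (CommutativeRing; CommutativeSemiring)
import Algebra.Solver.Ring.NaturalCoefficients.Default as NaturalCoefficientSolver
import Relation.Binary.Reasoning.Setoid as SetoidReasoning

-- Idea: write L = 1 - q^{2m}, D_k = ∏_{i<m} (1 + q^{2k+2i}) and P_k = ∏_{i≤m} (1 + q^{2k+2i}),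
-- so that P_k = D_k (1 + q^{2k} q^{2m}) = D_{k+1} (1 + q^{2k}). The partial fraction identity
--   1/(L D_k) = 1/P_k + q^{2m}/(L D_{k+1})
-- multiplied by q^{2mk} ∏_{i=1}^{m} q^{2i-1} says that the k-th summand T_k is the difference of
-- consecutive remainders R_k = q^{2mk} ∏_{i=1}^{m} q^{2i-1} / (L D_k). Hence
-- Σ_{k=1}^{K} T_k = R_1 - R_{K+1}, where R_1 is the right-hand side and R_{K+1} has q-adic
-- order 2m(K+1) > K.

-- Placed before the imports below, whose ℕ operations _+_ and _*_ would clash with those of R.
module _ {c ℓ} (R : CommutativeSemiring c ℓ) where
  open CommutativeSemiring R
  open NaturalCoefficientSolver R using (solve; _:=_; _:+_; _:*_; con)
  open SetoidReasoning setoid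

  inverse-of-factor : ∀ {x x⁻ y y⁻ e} →
    x * x⁻ ≈ 1# → y * y⁻ ≈ 1# → y ≈ x * e → x⁻ ≈ e * y⁻
  inverse-of-factor {x} {x⁻} {y} {y⁻} {e} xx⁻≈1 yy⁻≈1 y≈xe = begin
    x⁻                  ≈⟨ *-identityʳ x⁻ ⟨
    x⁻ * 1#             ≈⟨ *-congˡ yy⁻≈1 ⟨
    x⁻ * (y * y⁻)       ≈⟨ *-congˡ (*-congʳ y≈xe) ⟩
    x⁻ * ((x * e) * y⁻) ≈⟨ solve 4 (λ x⁻ x e y⁻ → x⁻ :* ((x :* e) :* y⁻)
                                              := (x :* x⁻) :* (e :* y⁻))
                                 refl x⁻ x e y⁻ ⟩
    (x * x⁻) * (e * y⁻) ≈⟨ *-congʳ xx⁻≈1 ⟩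
    1# * (e * y⁻)       ≈⟨ *-identityˡ (e * y⁻) ⟩
    e * y⁻              ∎

  partial-fraction : ∀ {u v L L⁻ D D⁻ D′ D′⁻ P P⁻} →
    L + v ≈ 1# → L * L⁻ ≈ 1# → D * D⁻ ≈ 1# → D′ * D′⁻ ≈ 1# → P * P⁻ ≈ 1# →
    P ≈ D * (1# + u * v) → P ≈ D′ * (1# + u) →
    L⁻ * D⁻ ≈ P⁻ + v * (L⁻ * D′⁻)
  partial-fraction {u} {v} {L} {L⁻} {D⁻ = D⁻} {D′⁻ = D′⁻} {P⁻ = P⁻}
                   L+v≈1 LL⁻≈1 DD⁻≈1 D′D′⁻≈1 PP⁻≈1 P≈D[1+uv] P≈D′[1+u] = begin
    L⁻ * D⁻                                    ≈⟨ *-congˡ (inverse-of-factor DD⁻≈1 PP⁻≈1 P≈D[1+uv]) ⟩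
    L⁻ * ((1# + u * v) * P⁻)                   ≈⟨ *-congˡ (*-congʳ (+-congʳ L+v≈1)) ⟨
    L⁻ * (((L + v) + u * v) * P⁻)              ≈⟨ solve 5 (λ u v L L⁻ P⁻ →
                                                       L⁻ :* (((L :+ v) :+ u :* v) :* P⁻)
                                                    := (L :* L⁻) :* P⁻ :+ v :* (L⁻ :* ((con 1 :+ u) :* P⁻)))
                                                    refl u v L L⁻ P⁻ ⟩
    (L * L⁻) * P⁻ + v * (L⁻ * ((1# + u) * P⁻)) ≈⟨ +-cong (trans (*-congʳ LL⁻≈1) (*-identityˡ P⁻))
                                                        (*-congˡ (*-congˡ (sym D′⁻≈[1+u]P⁻))) ⟩
    P⁻ + v * (L⁻ * D′⁻)                        ∎
    where D′⁻≈[1+u]P⁻ = inverse-of-factor D′D′⁻≈1 PP⁻≈1 P≈D′[1+u]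

open import Defs
open import Data.Nat using (ℕ; suc; _≤_; _+_; _*_; _∸_)
open import Data.Product using (∃-syntax)
open import Relation.Binary.PropositionalEquality using (_≡_)

import Algebra.Construct.Pointwise as Pointwise
import Algebra.Properties.CommutativeSemigroup as CommutativeSemigroupProperties
open import Data.Bool using (if_then_else_)
open import Data.Integer using (ℤ; 0ℤ; 1ℤ) renaming (_+_ to _+ℤ_; _*_ to _*ℤ_; -_ to -ℤ_)
import Data.Integer.Properties as ℤ
open import Data.Nat using (zero; _<_; z≤n; s≤s; _≟_; _≤?_; _≡ᵇ_)
import Data.Nat.Properties as ℕ
open import Data.Nat.Tactic.RingSolver using (solve-∀)
open import Data.Product using (_,_)
open import Function using (_∘_)
open import Level using (0ℓ)
open import Relation.Binary.PropositionalEquality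
  using (_≢_; _≗_; refl; sym; trans; cong; cong₂; module ≡-Reasoning)
open import Relation.Nullary using (yes; no)
open import Relation.Nullary.Decidable using (dec-true; dec-false)

sumTo-cong : ∀ n {f g : ℕ → ℤ} → (∀ i → i < n → f i ≡ g i) → sumTo n f ≡ sumTo n g
sumTo-cong zero    f≡g = refl
sumTo-cong (suc n) f≡g =
  cong₂ _+ℤ_ (sumTo-cong n (λ i i<n → f≡g i (ℕ.m<n⇒m<1+n i<n))) (f≡g n ℕ.≤-refl)

sumTo-sucˡ : ∀ n (f : ℕ → ℤ) → sumTo (suc n) f ≡ f 0 +ℤ sumTo n (f ∘ suc)
sumTo-sucˡ zero    f = trans (ℤ.+-identityˡ (f 0)) (sym (ℤ.+-identityʳ (f 0)))
sumTo-sucˡ (suc n) f = trans (cong (_+ℤ f (suc n)) (sumTo-sucˡ n f)) (ℤ.+-assoc (f 0) _ _)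

sumTo-distrib-+ : ∀ n (f g : ℕ → ℤ) → sumTo n (λ i → f i +ℤ g i) ≡ sumTo n f +ℤ sumTo n g
sumTo-distrib-+ zero    f g = refl
sumTo-distrib-+ (suc n) f g =
  trans (cong (_+ℤ (f n +ℤ g n)) (sumTo-distrib-+ n f g)) (interchange (sumTo n f) (sumTo n g) (f n) (g n))
  where open CommutativeSemigroupProperties ℤ.+-commutativeSemigroup using (interchange)

*-distribˡ-sumTo : ∀ n c (f : ℕ → ℤ) → c *ℤ sumTo n f ≡ sumTo n (λ i → c *ℤ f i)
*-distribˡ-sumTo zero    c f = ℤ.*-zeroʳ c
*-distribˡ-sumTo (suc n) c f =
  trans (ℤ.*-distribˡ-+ c (sumTo n f) (f n)) (cong (_+ℤ c *ℤ f n) (*-distribˡ-sumTo n c f))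

*-distribʳ-sumTo : ∀ n c (f : ℕ → ℤ) → sumTo n f *ℤ c ≡ sumTo n (λ i → f i *ℤ c)
*-distribʳ-sumTo zero    c f = ℤ.*-zeroˡ c
*-distribʳ-sumTo (suc n) c f =
  trans (ℤ.*-distribʳ-+ c (sumTo n f) (f n)) (cong (_+ℤ f n *ℤ c) (*-distribʳ-sumTo n c f))

sumTo-reverse : ∀ n (f : ℕ → ℤ) → sumTo (suc n) f ≡ sumTo (suc n) (λ i → f (n ∸ i))
sumTo-reverse zero    f = refl
sumTo-reverse (suc n) f = begin
  sumTo (suc n) f +ℤ f (suc n)                 ≡⟨ cong (_+ℤ f (suc n)) (sumTo-reverse n f) ⟩
  sumTo (suc n) (λ i → f (n ∸ i)) +ℤ f (suc n) ≡⟨ ℤ.+-comm _ (f (suc n)) ⟩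
  f (suc n) +ℤ sumTo (suc n) (λ i → f (n ∸ i)) ≡⟨ sumTo-sucˡ (suc n) (λ i → f (suc n ∸ i)) ⟨
  sumTo (suc (suc n)) (λ i → f (suc n ∸ i))    ∎
  where open ≡-Reasoning

sumTo-triangle : ∀ n (F : ℕ → ℕ → ℤ) →
  sumTo (suc n) (λ i → sumTo (suc i) (λ j → F j (i ∸ j)))
  ≡ sumTo (suc n) (λ j → sumTo (suc (n ∸ j)) (F j))
sumTo-triangle zero    F = refl
sumTo-triangle (suc n) F = begin
  sumTo (suc n) (λ i → sumTo (suc i) (λ j → F j (i ∸ j))) +ℤ sumTo (suc (suc n)) diagonal
    ≡⟨ cong (_+ℤ sumTo (suc (suc n)) diagonal) (sumTo-triangle n F) ⟩
  sumTo (suc n) (λ j → sumTo (suc (n ∸ j)) (F j)) +ℤ sumTo (suc (suc n)) diagonal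
    ≡⟨ cong (_+ℤ sumTo (suc (suc n)) diagonal) rows-up-to-n ⟩
  sumTo (suc (suc n)) (λ j → sumTo (suc n ∸ j) (F j)) +ℤ sumTo (suc (suc n)) diagonal
    ≡⟨ sumTo-distrib-+ (suc (suc n)) (λ j → sumTo (suc n ∸ j) (F j)) diagonal ⟨
  sumTo (suc (suc n)) (λ j → sumTo (suc (suc n ∸ j)) (F j)) ∎
  where
  open ≡-Reasoning
  diagonal : ℕ → ℤ
  diagonal j = F j (suc n ∸ j)
  rows-up-to-n : sumTo (suc n) (λ j → sumTo (suc (n ∸ j)) (F j))
               ≡ sumTo (suc (suc n)) (λ j → sumTo (suc n ∸ j) (F j))
  rows-up-to-n = begin
    sumTo (suc n) (λ j → sumTo (suc (n ∸ j)) (F j))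
      ≡⟨ sumTo-cong (suc n) (λ j j<1+n →
           cong (λ l → sumTo l (F j)) (sym (ℕ.+-∸-assoc 1 (ℕ.≤-pred j<1+n)))) ⟩
    sumTo (suc n) (λ j → sumTo (suc n ∸ j) (F j))
      ≡⟨ ℤ.+-identityʳ _ ⟨
    sumTo (suc n) (λ j → sumTo (suc n ∸ j) (F j)) +ℤ sumTo 0 (F (suc n))
      ≡⟨ cong (λ l → sumTo (suc n) (λ j → sumTo (suc n ∸ j) (F j)) +ℤ sumTo l (F (suc n)))
              (ℕ.n∸n≡0 n) ⟨
    sumTo (suc (suc n)) (λ j → sumTo (suc n ∸ j) (F j)) ∎

qpow-diagonal : ∀ e → qpow e e ≡ 1ℤ
qpow-diagonal e = cong (λ b → if b then 1ℤ else 0ℤ) (dec-true (e ≟ e) refl)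

qpow-off-diagonal : ∀ {e n} → n ≢ e → qpow e n ≡ 0ℤ
qpow-off-diagonal {e} {n} n≢e = cong (λ b → if b then 1ℤ else 0ℤ) (dec-false (n ≟ e) n≢e)

sumTo-qpow-*-vanishes : ∀ a (h : ℕ → ℤ) N → N ≤ a → sumTo N (λ i → qpow a i *ℤ h i) ≡ 0ℤ
sumTo-qpow-*-vanishes a h zero    _     = refl
sumTo-qpow-*-vanishes a h (suc N) N<a =
  cong₂ _+ℤ_ (sumTo-qpow-*-vanishes a h N (ℕ.<⇒≤ N<a))
             (cong (_*ℤ h N) (qpow-off-diagonal (ℕ.<⇒≢ N<a)))

sumTo-qpow-*-sifts : ∀ a (h : ℕ → ℤ) N → a < N → sumTo N (λ i → qpow a i *ℤ h i) ≡ h a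
sumTo-qpow-*-sifts a h (suc N) (s≤s a≤N) with a ≟ N
... | yes refl = begin
  sumTo a (λ i → qpow a i *ℤ h i) +ℤ qpow a a *ℤ h a
    ≡⟨ cong₂ _+ℤ_ (sumTo-qpow-*-vanishes a h a ℕ.≤-refl) (cong (_*ℤ h a) (qpow-diagonal a)) ⟩
  0ℤ +ℤ 1ℤ *ℤ h a
    ≡⟨ trans (ℤ.+-identityˡ _) (ℤ.*-identityˡ (h a)) ⟩
  h a ∎
  where open ≡-Reasoning
... | no a≢N = begin
  sumTo N (λ i → qpow a i *ℤ h i) +ℤ qpow a N *ℤ h N
    ≡⟨ cong₂ _+ℤ_ (sumTo-qpow-*-sifts a h N (ℕ.≤∧≢⇒< a≤N a≢N))
                  (cong (_*ℤ h N) (qpow-off-diagonal (a≢N ∘ sym))) ⟩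
  h a +ℤ 0ℤ *ℤ h N
    ≡⟨ ℤ.+-identityʳ (h a) ⟩
  h a ∎
  where open ≡-Reasoning

qpow-⊛-below : ∀ a g {n} → n < a → (qpow a ⊛ g) n ≡ 0ℤ
qpow-⊛-below a g {n} n<a = sumTo-qpow-*-vanishes a (λ i → g (n ∸ i)) (suc n) n<a

qpow-⊛-above : ∀ a g {n} → a ≤ n → (qpow a ⊛ g) n ≡ g (n ∸ a)
qpow-⊛-above a g {n} a≤n = sumTo-qpow-*-sifts a (λ i → g (n ∸ i)) (suc n) (s≤s a≤n)

qpow-+ : ∀ a b → qpow (a + b) ≗ qpow a ⊛ qpow b
qpow-+ a b n with a ≤? n
... | no a≰n = trans (qpow-off-diagonal n≢a+b) (sym (qpow-⊛-below a (qpow b) (ℕ.≰⇒> a≰n)))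
  where
  n≢a+b : n ≢ a + b
  n≢a+b refl = a≰n (ℕ.m≤m+n a b)
... | yes a≤n with n ≟ a + b
...   | yes refl = begin
  qpow (a + b) (a + b) ≡⟨ qpow-diagonal (a + b) ⟩
  1ℤ                   ≡⟨ qpow-diagonal b ⟨
  qpow b b             ≡⟨ cong (qpow b) (ℕ.m+n∸m≡n a b) ⟨
  qpow b (a + b ∸ a)   ≡⟨ qpow-⊛-above a (qpow b) a≤n ⟨
  (qpow a ⊛ qpow b) (a + b) ∎
  where open ≡-Reasoning
...   | no n≢a+b = begin
  qpow (a + b) n       ≡⟨ qpow-off-diagonal n≢a+b ⟩
  0ℤ                   ≡⟨ qpow-off-diagonal (n≢a+b ∘ n∸a≡b⇒n≡a+b) ⟨
  qpow b (n ∸ a)       ≡⟨ qpow-⊛-above a (qpow b) a≤n ⟨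
  (qpow a ⊛ qpow b) n  ∎
  where
  open ≡-Reasoning
  n∸a≡b⇒n≡a+b : n ∸ a ≡ b → n ≡ a + b
  n∸a≡b⇒n≡a+b n∸a≡b = trans (sym (ℕ.m+[n∸m]≡n a≤n)) (cong (a +_) n∸a≡b)

-- The ring of formal power series

⊛-cong : ∀ {f f′ g g′} → f ≗ f′ → g ≗ g′ → f ⊛ g ≗ f′ ⊛ g′
⊛-cong f≗f′ g≗g′ n = sumTo-cong (suc n) (λ i _ → cong₂ _*ℤ_ (f≗f′ i) (g≗g′ (n ∸ i)))

⊛-comm : ∀ f g → f ⊛ g ≗ g ⊛ f
⊛-comm f g n = trans (sumTo-reverse n _) (sumTo-cong (suc n) λ i i<1+n →
  trans (cong (λ j → f (n ∸ i) *ℤ g j) (ℕ.m∸[m∸n]≡n (ℕ.≤-pred i<1+n)))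
        (ℤ.*-comm (f (n ∸ i)) (g i)))

⊛-assoc : ∀ f g h → (f ⊛ g) ⊛ h ≗ f ⊛ (g ⊛ h)
⊛-assoc f g h n = begin
  sumTo (suc n) (λ i → sumTo (suc i) (λ j → f j *ℤ g (i ∸ j)) *ℤ h (n ∸ i))
    ≡⟨ sumTo-cong (suc n) (λ i _ → *-distribʳ-sumTo (suc i) (h (n ∸ i)) (λ j → f j *ℤ g (i ∸ j))) ⟩
  sumTo (suc n) (λ i → sumTo (suc i) (λ j → f j *ℤ g (i ∸ j) *ℤ h (n ∸ i)))
    ≡⟨ sumTo-cong (suc n) (λ i _ → sumTo-cong (suc i) (λ j j<1+i →
         cong (λ l → f j *ℤ g (i ∸ j) *ℤ h (n ∸ l)) (sym (ℕ.m+[n∸m]≡n (ℕ.≤-pred j<1+i))))) ⟩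
  sumTo (suc n) (λ i → sumTo (suc i) (λ j → F j (i ∸ j)))
    ≡⟨ sumTo-triangle n F ⟩
  sumTo (suc n) (λ j → sumTo (suc (n ∸ j)) (F j))
    ≡⟨ sumTo-cong (suc n) (λ j _ → trans (sumTo-cong (suc (n ∸ j)) (λ l _ → F≡ j l))
                                          (sym (*-distribˡ-sumTo (suc (n ∸ j)) (f j) _))) ⟩
  sumTo (suc n) (λ j → f j *ℤ sumTo (suc (n ∸ j)) (λ l → g l *ℤ h (n ∸ j ∸ l))) ∎
  where
  open ≡-Reasoning
  F : ℕ → ℕ → ℤ
  F j l = f j *ℤ g l *ℤ h (n ∸ (j + l))
  F≡ : ∀ j l → F j l ≡ f j *ℤ (g l *ℤ h (n ∸ j ∸ l))
  F≡ j l = trans (ℤ.*-assoc (f j) (g l) _) (cong (λ e → f j *ℤ (g l *ℤ h e)) (sym (ℕ.∸-+-assoc n j l)))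

⊛-distribˡ-⊕ : ∀ f g h → f ⊛ (g ⊕ h) ≗ (f ⊛ g) ⊕ (f ⊛ h)
⊛-distribˡ-⊕ f g h n =
  trans (sumTo-cong (suc n) (λ i _ → ℤ.*-distribˡ-+ (f i) (g (n ∸ i)) (h (n ∸ i))))
        (sumTo-distrib-+ (suc n) _ _)

⊛-distribʳ-⊕ : ∀ f g h → (g ⊕ h) ⊛ f ≗ (g ⊛ f) ⊕ (h ⊛ f)
⊛-distribʳ-⊕ f g h n =
  trans (sumTo-cong (suc n) (λ i _ → ℤ.*-distribʳ-+ (f (n ∸ i)) (g i) (h i)))
        (sumTo-distrib-+ (suc n) _ _)

⊛-at-0 : ∀ f g → (f ⊛ g) 0 ≡ f 0 *ℤ g 0
⊛-at-0 f g = ℤ.+-identityˡ (f 0 *ℤ g 0)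

one-⊛ : ∀ g → one ⊛ g ≗ g
one-⊛ g n = qpow-⊛-above 0 g z≤n

⊛-one : ∀ g → g ⊛ one ≗ g
⊛-one g n = trans (⊛-comm g one n) (one-⊛ g n)

SeriesRing : CommutativeRing 0ℓ 0ℓ
SeriesRing = record
  { _≈_ = _≗_
  ; _+_ = _⊕_
  ; _*_ = _⊛_
  ; -_  = ⊖_
  ; 0#  = λ _ → 0ℤ
  ; 1#  = one
  ; isCommutativeRing = record
    { isRing = record
      { +-isAbelianGroup = Pointwise.isAbelianGroup ℕ ℤ.+-0-isAbelianGroup
      ; *-cong     = ⊛-cong
      ; *-assoc    = ⊛-assoc
      ; *-identity = one-⊛ , ⊛-one
      ; distrib    = ⊛-distribˡ-⊕ , ⊛-distribʳ-⊕
      }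
    ; *-comm = ⊛-comm
    }
  }

open CommutativeRing SeriesRing using (setoid; commutativeSemiring; *-commutativeSemigroup;
  +-cong; +-congˡ; +-identityˡ; +-assoc; *-cong; *-congˡ; *-congʳ; *-comm; reflexive)
  renaming (sym to ≈-sym; trans to ≈-trans)

-- Inverses

invApprox-cong : ∀ {f g} → f ≗ g → ∀ n i → invApprox f n i ≡ invApprox g n i
invApprox-cong f≗g zero    i = refl
invApprox-cong f≗g (suc n) i = cong₂ (λ new old → if i ≡ᵇ suc n then new else old)
  (cong -ℤ_ (sumTo-cong (suc n) (λ j _ → cong₂ _*ℤ_ (f≗g (suc j)) (invApprox-cong f≗g n (n ∸ j)))))
  (invApprox-cong f≗g n i)

inv-cong : ∀ {f g} → f ≗ g → inv f ≗ inv g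
inv-cong f≗g n = invApprox-cong f≗g n n

invApprox-next : Series → ℕ → ℤ
invApprox-next f n = -ℤ sumTo (suc n) (λ j → f (suc j) *ℤ invApprox f n (n ∸ j))

invApprox-stable : ∀ f {n j} → j ≤ n → invApprox f n j ≡ inv f j
invApprox-stable f {zero}  z≤n = refl
invApprox-stable f {suc n} {j} j≤1+n with j ≟ suc n
... | yes refl = refl
... | no j≢1+n = trans invApprox-suc-off (invApprox-stable f (ℕ.≤-pred (ℕ.≤∧≢⇒< j≤1+n j≢1+n)))
  where
  invApprox-suc-off : invApprox f (suc n) j ≡ invApprox f n j
  invApprox-suc-off = cong (λ b → if b then invApprox-next f n else invApprox f n j)
                           (dec-false (j ≟ suc n) j≢1+n)

inv-suc : ∀ f n → inv f (suc n) ≡ invApprox-next f n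
inv-suc f n = cong (λ b → if b then invApprox-next f n else invApprox f n (suc n)) (dec-true (suc n ≟ suc n) refl)

⊛-inv : ∀ f → f 0 ≡ 1ℤ → f ⊛ inv f ≗ one
⊛-inv f f₀≡1 zero    = trans (⊛-at-0 f (inv f)) (cong (_*ℤ 1ℤ) f₀≡1)
⊛-inv f f₀≡1 (suc n) = begin
  sumTo (suc (suc n)) (λ i → f i *ℤ inv f (suc n ∸ i))
    ≡⟨ sumTo-sucˡ (suc n) _ ⟩
  f 0 *ℤ inv f (suc n) +ℤ sumTo (suc n) (λ i → f (suc i) *ℤ inv f (n ∸ i))
    ≡⟨ cong₂ _+ℤ_ (cong₂ _*ℤ_ f₀≡1 (inv-suc f n))
         (sumTo-cong (suc n) (λ i _ → cong (f (suc i) *ℤ_) (sym (invApprox-stable f (ℕ.m∸n≤m n i))))) ⟩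
  1ℤ *ℤ (-ℤ X) +ℤ X
    ≡⟨ cong (_+ℤ X) (ℤ.*-identityˡ (-ℤ X)) ⟩
  -ℤ X +ℤ X
    ≡⟨ ℤ.+-inverseˡ X ⟩
  0ℤ ∎
  where
  open ≡-Reasoning
  X : ℤ
  X = sumTo (suc n) (λ j → f (suc j) *ℤ invApprox f n (n ∸ j))

prodTo-cong : ∀ m {F G : ℕ → Series} → (∀ i → F i ≗ G i) → prodTo m F ≗ prodTo m G
prodTo-cong zero    F≗G = λ _ → refl
prodTo-cong (suc m) F≗G = ⊛-cong (prodTo-cong m F≗G) (F≗G m)

prodTo-sucˡ : ∀ m (F : ℕ → Series) → prodTo (suc m) F ≗ F 0 ⊛ prodTo m (F ∘ suc)
prodTo-sucˡ zero    F = ≈-trans (one-⊛ (F 0)) (≈-sym (⊛-one (F 0)))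
prodTo-sucˡ (suc m) F =
  ≈-trans (*-congʳ {F (suc m)} (prodTo-sucˡ m F)) (⊛-assoc (F 0) (prodTo m (F ∘ suc)) (F (suc m)))

prodTo-at-0 : ∀ m (F : ℕ → Series) → (∀ i → F i 0 ≡ 1ℤ) → prodTo m F 0 ≡ 1ℤ
prodTo-at-0 zero    F F₀≡1 = refl
prodTo-at-0 (suc m) F F₀≡1 =
  trans (⊛-at-0 (prodTo m F) (F m)) (cong₂ _*ℤ_ (prodTo-at-0 m F F₀≡1) (F₀≡1 m))

prodTo-⊛ : ∀ m (F G : ℕ → Series) → prodTo m (λ i → F i ⊛ G i) ≗ prodTo m F ⊛ prodTo m G
prodTo-⊛ zero    F G = ≈-sym (one-⊛ one)
prodTo-⊛ (suc m) F G =
  ≈-trans (*-congʳ {F m ⊛ G m} (prodTo-⊛ m F G)) (interchange (prodTo m F) (prodTo m G) (F m) (G m))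
  where open CommutativeSemigroupProperties *-commutativeSemigroup using (interchange)

prodTo-qpow : ∀ m c → prodTo m (λ _ → qpow c) ≗ qpow (m * c)
prodTo-qpow zero    c = λ _ → refl
prodTo-qpow (suc m) c = ≈-trans (*-congʳ {qpow c} (prodTo-qpow m c))
  (≈-trans (≈-sym (qpow-+ (m * c) c)) (reflexive (cong qpow (ℕ.+-comm (m * c) c))))

sumSeries-telescope : ∀ (a t : ℕ → Series) → (∀ k → a k ≗ t k ⊕ a (suc k)) →
  ∀ K → a 0 ≗ sumSeries K t ⊕ a K
sumSeries-telescope a t step zero    = ≈-sym (+-identityˡ (a 0))
sumSeries-telescope a t step (suc K) = ≈-trans (sumSeries-telescope a t step K)
  (≈-trans (+-congˡ {sumSeries K t} (step K)) (≈-sym (+-assoc (sumSeries K t) (t K) (a (suc K)))))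

-- The telescoping argument

open NaturalCoefficientSolver commutativeSemiring using (solve; _:=_; _:+_; _:*_)

-- With m = suc m′, the constant term L 0 ≡ 1ℤ holds by computation, and m * x ≥ x.
module _ (m′ : ℕ) where
  m : ℕ
  m = suc m′

  v L N₀ : Series
  v  = qpow (2 * m)
  L  = one ⊝ v
  N₀ = prodTo m (λ j → qpow (2 * suc j ∸ 1))

  factor : ℕ → ℕ → Series
  factor k i = one ⊕ qpow (2 * k + 2 * i)

  numerator D P term remainder : ℕ → Series
  numerator k = prodTo m (λ j → qpow (2 * k + 2 * suc j ∸ 1))
  D k         = prodTo m (factor k)
  P k         = prodTo (suc m) (factor k)
  term k      = numerator k ⊘ P k
  remainder k = (qpow (m * (2 * k)) ⊘ L) ⊛ (N₀ ⊘ D k)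

  L⊕v≗one : L ⊕ v ≗ one
  L⊕v≗one n = trans (ℤ.+-assoc (one n) (-ℤ v n) (v n))
                    (trans (cong (one n +ℤ_) (ℤ.+-inverseˡ (v n))) (ℤ.+-identityʳ (one n)))

  numerator-factors : ∀ k → numerator k ≗ qpow (m * (2 * k)) ⊛ N₀
  numerator-factors k = begin
    numerator k                                          ≈⟨ prodTo-cong m split ⟩
    prodTo m (λ j → qpow (2 * k) ⊛ qpow (2 * suc j ∸ 1)) ≈⟨ prodTo-⊛ m _ _ ⟩
    prodTo m (λ _ → qpow (2 * k)) ⊛ N₀                   ≈⟨ *-congʳ {N₀} (prodTo-qpow m (2 * k)) ⟩
    qpow (m * (2 * k)) ⊛ N₀                              ∎
    where
    open SetoidReasoning setoid
    split : ∀ j → qpow (2 * k + 2 * suc j ∸ 1) ≗ qpow (2 * k) ⊛ qpow (2 * suc j ∸ 1)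
    split j = ≈-trans (reflexive (cong qpow (ℕ.+-∸-assoc (2 * k) (s≤s z≤n)))) (qpow-+ (2 * k) _)

  P-splits-last : ∀ k → P k ≗ D k ⊛ (one ⊕ (qpow (2 * k) ⊛ v))
  P-splits-last k = *-congˡ {D k} (+-congˡ {one} (qpow-+ (2 * k) (2 * m)))

  P-splits-first : ∀ k → P k ≗ D (suc k) ⊛ (one ⊕ qpow (2 * k))
  P-splits-first k = begin
    P k                                    ≈⟨ prodTo-sucˡ m (factor k) ⟩
    factor k 0 ⊛ prodTo m (factor k ∘ suc) ≈⟨ *-comm (factor k 0) (prodTo m (factor k ∘ suc)) ⟩
    prodTo m (factor k ∘ suc) ⊛ factor k 0 ≈⟨ *-cong (prodTo-cong m (λ i → factor-exponent (exponent k i)))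
                                                     (factor-exponent (ℕ.+-identityʳ (2 * k))) ⟩
    D (suc k) ⊛ (one ⊕ qpow (2 * k))       ∎
    where
    open SetoidReasoning setoid
    factor-exponent : ∀ {a b} → a ≡ b → one ⊕ qpow a ≗ one ⊕ qpow b
    factor-exponent a≡b = reflexive (cong (λ e → one ⊕ qpow e) a≡b)
    exponent : ∀ k i → 2 * k + 2 * suc i ≡ 2 * suc k + 2 * i
    exponent = solve-∀

  L-invertible : L ⊛ inv L ≗ one
  L-invertible = ⊛-inv L refl

  D-invertible : ∀ k → D (suc k) ⊛ inv (D (suc k)) ≗ one
  D-invertible k = ⊛-inv (D (suc k)) (prodTo-at-0 m (factor (suc k)) λ _ → refl)

  P-invertible : ∀ k → P (suc k) ⊛ inv (P (suc k)) ≗ one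
  P-invertible k = ⊛-inv (P (suc k)) (prodTo-at-0 (suc m) (factor (suc k)) λ _ → refl)

  inv-L⊛D-partial-fraction : ∀ k →
    inv L ⊛ inv (D (suc k)) ≗ inv (P (suc k)) ⊕ (v ⊛ (inv L ⊛ inv (D (suc (suc k)))))
  inv-L⊛D-partial-fraction k =
    partial-fraction commutativeSemiring {u = qpow (2 * suc k)} {v} {L} {inv L} {D (suc k)} {inv (D (suc k))}
      {D (suc (suc k))} {inv (D (suc (suc k)))} {P (suc k)} {inv (P (suc k))}
      L⊕v≗one L-invertible (D-invertible k) (D-invertible (suc k)) (P-invertible k)
      (P-splits-last (suc k)) (P-splits-first (suc k))

  remainder-step : ∀ k → remainder (suc k) ≗ term (suc k) ⊕ remainder (suc (suc k))
  remainder-step k′ = begin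
    (w ⊛ inv L) ⊛ (N₀ ⊛ inv (D k))
      ≈⟨ interchange w (inv L) N₀ (inv (D k)) ⟩
    (w ⊛ N₀) ⊛ (inv L ⊛ inv (D k))
      ≈⟨ *-congˡ {w ⊛ N₀} (inv-L⊛D-partial-fraction k′) ⟩
    (w ⊛ N₀) ⊛ (inv (P k) ⊕ (v ⊛ (inv L ⊛ inv (D (suc k)))))
      ≈⟨ solve 6 (λ W N I V A B → (W :* N) :* (I :+ V :* (A :* B))
                               := (W :* N) :* I :+ ((W :* V) :* A) :* (N :* B))
                 (λ _ → refl) w N₀ (inv (P k)) v (inv L) (inv (D (suc k))) ⟩
    ((w ⊛ N₀) ⊛ inv (P k)) ⊕ (((w ⊛ v) ⊛ inv L) ⊛ (N₀ ⊛ inv (D (suc k))))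
      ≈⟨ +-cong (*-congʳ {inv (P k)} (≈-sym (numerator-factors k)))
                (*-congʳ {N₀ ⊛ inv (D (suc k))} (*-congʳ {inv L} w⊛v≗qpow)) ⟩
    term k ⊕ remainder (suc k) ∎
    where
    open SetoidReasoning setoid
    open CommutativeSemigroupProperties *-commutativeSemigroup using (interchange)
    k : ℕ
    k = suc k′
    w : Series
    w = qpow (m * (2 * k))
    exponent : ∀ a b → a * (2 * b) + 2 * a ≡ a * (2 * suc b)
    exponent = solve-∀
    w⊛v≗qpow : w ⊛ v ≗ qpow (m * (2 * suc k))
    w⊛v≗qpow = ≈-trans (≈-sym (qpow-+ (m * (2 * k)) (2 * m))) (reflexive (cong qpow (exponent m k)))

  remainder-vanishes : ∀ K {n} → n ≤ K → remainder (suc K) n ≡ 0ℤ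
  remainder-vanishes K {n} n≤K =
    trans (⊛-assoc (qpow e) (inv L) (N₀ ⊘ D (suc K)) n) (qpow-⊛-below e (inv L ⊛ (N₀ ⊘ D (suc K))) n<e)
    where
    e : ℕ
    e = m * (2 * suc K)
    n<e : n < e
    n<e = ℕ.≤-trans (s≤s n≤K) (ℕ.≤-trans (ℕ.m≤m+n (suc K) _) (ℕ.m≤m+n (2 * suc K) _))

  remainder-one : remainder 1 ≗ (qpow (2 * m) ⊘ L) ⊛ (N₀ ⊘ prodTo m (λ j → one ⊕ qpow (2 * suc j)))
  remainder-one = *-cong (*-congʳ {inv L} (reflexive (cong qpow (ℕ.*-comm m 2))))
    (*-congˡ {N₀} (inv-cong (prodTo-cong m (λ i → +-congˡ {one} (reflexive (cong qpow (sym (ℕ.*-suc 2 i))))))))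

  partial-sums-stabilise : ∀ K {n} → n ≤ K → sumSeries K (term ∘ suc) n ≡ remainder 1 n
  partial-sums-stabilise K {n} n≤K = begin
    S n                         ≡⟨ ℤ.+-identityʳ (S n) ⟨
    S n +ℤ 0ℤ                   ≡⟨ cong (S n +ℤ_) (remainder-vanishes K n≤K) ⟨
    (S ⊕ remainder (suc K)) n   ≡⟨ sumSeries-telescope (remainder ∘ suc) (term ∘ suc) remainder-step K n ⟨
    remainder 1 n               ∎
    where
    open ≡-Reasoning
    S : Series
    S = sumSeries K (term ∘ suc)

lemma4p2 : (m : ℕ) → 1 ≤ m → (n : ℕ) → ∃[ N ] ((K : ℕ) → N ≤ K →
    sumSeries K (λ k′ → let k = suc k′ in
        prodTo m (λ j → let i = suc j in qpow (2 * k + 2 * i ∸ 1))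
        ⊘ prodTo (suc m) (λ i → one ⊕ qpow (2 * k + 2 * i))) n
    ≡ ((qpow (2 * m) ⊘ (one ⊝ qpow (2 * m)))
        ⊛ (prodTo m (λ j → let i = suc j in qpow (2 * i ∸ 1))
           ⊘ prodTo m (λ j → let i = suc j in one ⊕ qpow (2 * i)))) n)
lemma4p2 zero     ()
lemma4p2 (suc m′) _  n = n , λ K n≤K → trans (partial-sums-stabilise m′ K n≤K) (remainder-one m′ n)
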